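{- For every integer $k\ge 1$, the star $K_{1,k}$ is $k$-$cfc$-critical.
   Context: For an edge-colored graph, a path is conflict-free if some color occurs on exactly one of its edges; $cfc(G)$ is the minimum number of colors in an edge-coloring of the connected graph $G$ in which every pair of distinct vertices is joined by a conflict-free path. A nontrivial tree $T$ is $cfc$-critical if for every edge $e$ of $T$, every nontrivial component $T'$ of $T-e$ satisfies $cfc(T')<cfc(T)$; it is $k$-$cfc$-critical if in addition $cfc(T)=k$. -}

module Defs where

open import Data.Nat using (ℕ; zero; suc; _≤_; _<_)
open import Data.Fin using (Fin) renaming (zero to fzero; suc to fsuc)
open import Data.Fin.Properties using () renaming (_≟_ to _≟ᶠ_)
open import Data.Bool using (Bool; true; false; _∧_; _∨_; not; _xor_)
open import Data.List using (List; []; _∷_; length; filter)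
open import Data.List.Relation.Unary.Unique.Propositional using (Unique)
open import Data.Product using (Σ; ∃; ∃-syntax; _×_)
open import Relation.Nullary using (¬_; Dec; yes; no)
open import Relation.Nullary.Decidable using (⌊_⌋)
open import Relation.Binary.PropositionalEquality using (_≡_; _≢_)

-- A finite simple graph whose vertex set is a subset of Fin n:
-- `vert v ≡ true` means v is a vertex; `adj u v ≡ true` means uv is an edge.
-- (All graphs built below are symmetric, irreflexive, and have edges only
-- between vertices of the vertex set.)
record Graph (n : ℕ) : Set where
  constructor mkGraph
  field
    vert : Fin n → Bool
    adj  : Fin n → Fin n → Bool
open Graph public

module _ {n : ℕ} (G : Graph n) where

  data Walk : Fin n → Fin n → Set where
    here : ∀ {u} → Walk u u
    step : ∀ {u w v} → adj G u w ≡ true → Walk w v → Walk u v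

  vertices : ∀ {u v} → Walk u v → List (Fin n)
  vertices (here {u}) = u ∷ []
  vertices (step {u} _ p) = u ∷ vertices p

  len : ∀ {u v} → Walk u v → ℕ
  len here = 0
  len (step _ p) = suc (len p)

  IsPath : ∀ {u v} → Walk u v → Set
  IsPath p = Unique (vertices p)

  Connected : Set
  Connected = ∀ u v → vert G u ≡ true → vert G v ≡ true → Walk u v

  -- a cycle u, w, ..., u of length ≥ 3 with distinct vertices
  HasCycle : Set
  HasCycle = Σ (Fin n) λ u → Σ (Fin n) λ w → adj G u w ≡ true ×
             Σ (Walk w u) λ p → (2 ≤ len p) × IsPath p

  IsTree : Set
  IsTree = Connected × ¬ HasCycle

  Nontrivial : Set
  Nontrivial = Σ (Fin n) λ u → Σ (Fin n) λ v →
               vert G u ≡ true × vert G v ≡ true × u ≢ v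

  colors : ∀ {k} → (Fin n → Fin n → Fin k) → ∀ {u v} → Walk u v → List (Fin k)
  colors c here = []
  colors c (step {u} {w} _ p) = c u w ∷ colors c p

  occ : ∀ {k} → Fin k → List (Fin k) → ℕ
  occ a xs = length (filter (λ x → x ≟ᶠ a) xs)

  CFPath : ∀ {k} → (Fin n → Fin n → Fin k) → Fin n → Fin n → Set
  CFPath {k} c u v = Σ (Walk u v) λ p → IsPath p ×
                     Σ (Fin k) λ a → occ a (colors c p) ≡ 1

  -- an edge-coloring with colors from Fin k (symmetric, i.e. colors the
  -- unordered edges) making G conflict-free connected
  CFColoring : ℕ → Set
  CFColoring k = Σ (Fin n → Fin n → Fin k) λ c →
                 (∀ u v → c u v ≡ c v u) ×
                 (∀ u v → vert G u ≡ true → vert G v ≡ true → u ≢ v → CFPath c u v)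

  IsCfc : ℕ → Set
  IsCfc k = CFColoring k × (∀ j → CFColoring j → k ≤ j)

_==_ : ∀ {n} → Fin n → Fin n → Bool
a == b = ⌊ a ≟ᶠ b ⌋

removeEdge : ∀ {n} → Graph n → Fin n → Fin n → Graph n
removeEdge G a b = mkGraph (vert G)
  (λ x y → adj G x y ∧ not ((x == a ∧ y == b) ∨ (x == b ∧ y == a)))

induced : ∀ {n} → Graph n → (Fin n → Bool) → Graph n
induced G S = mkGraph S (λ x y → S x ∧ S y ∧ adj G x y)

IsComponent : ∀ {n} → Graph n → (Fin n → Bool) → Set
IsComponent {n} G S =
  (∀ x → S x ≡ true → vert G x ≡ true) ×
  (Σ (Fin n) λ x → S x ≡ true) ×
  (∀ x y → S x ≡ true → adj G x y ≡ true → S y ≡ true) ×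
  Connected (induced G S)

KCfcCritical : ∀ {n} → ℕ → Graph n → Set
KCfcCritical {n} k T =
  IsTree T × Nontrivial T × IsCfc T k ×
  (∀ a b → adj T a b ≡ true → ∀ S → IsComponent (removeEdge T a b) S →
     Nontrivial (induced (removeEdge T a b) S) →
     Σ ℕ λ j → IsCfc (induced (removeEdge T a b) S) j × j < k)

isCenter : ∀ {k} → Fin (suc k) → Bool
isCenter fzero = true
isCenter (fsuc _) = false

star : (k : ℕ) → Graph (suc k)
star k = mkGraph (λ _ → true) (λ u v → isCenter u xor isCenter v)

module Submission where

-- Everything rests on the rigid shape of paths in a subgraph G of the star
-- (a "substar"): two distinct leaves are joined only through the centre, so
-- a conflict-free path between them needs the two spokes to carry different
-- colours.  Hence:
--   * lower bound: in a conflict-free colouring of a substar, the spokes to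
--     its leaves have pairwise distinct colours, so #colours ≥ #leaves;
--   * upper bound: if every leaf of G is joined to the centre, colouring the
--     spokes with pairwise distinct colours is conflict-free.
-- Together they give cfc(G) = #leaves for such substars (substar-isCfc),
-- in particular cfc(K_{1,k}) = k.  Deleting an edge of the star, i.e. the
-- spoke to some leaf i, isolates that leaf; the only nontrivial component is
-- the centre with the other k - 1 leaves (there is none when k = 1), and its
-- cfc is k - 1 < k.  Acyclicity holds for every substar: a cycle contains an
-- edge at the centre, and the rest of the cycle would revisit the centre.

open import Defs
open import Data.Nat using (ℕ; zero; suc; _≤_; _<_; s≤s)
open import Data.Nat.Properties using (≤-refl)
open import Data.Fin using (Fin; punchIn; punchOut) renaming (zero to fzero; suc to fsuc)
open import Data.Fin.Properties
  using (injective⇒≤; punchIn-injective; punchInᵢ≢i; punchOut-injective; suc-injective)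
  renaming (_≟_ to _≟ᶠ_)
open import Data.Bool using (Bool; true; false; _∧_; _∨_; not)
open import Data.Bool.Properties using (∨-comm)
open import Data.List using ([]; _∷_; length)
open import Data.List.Properties using (filter-accept; filter-reject)
open import Data.List.Relation.Unary.All using (All; []; _∷_)
open import Data.List.Relation.Unary.AllPairs using ([]; _∷_)
open import Data.Product using (Σ; _×_; _,_; proj₁; proj₂)
open import Data.Sum using (_⊎_; inj₁; inj₂)
open import Data.Empty using (⊥; ⊥-elim)
open import Relation.Nullary using (¬_; Dec; yes; no)
open import Relation.Binary.PropositionalEquality using (_≡_; _≢_; refl; sym; trans; cong; subst)
open import Function using (_∘_)
open import Function.Definitions using (Injective)

false≢true : false ≢ true
false≢true ()

∧-elimˡ : ∀ {x y} → x ∧ y ≡ true → x ≡ true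
∧-elimˡ {true}  _ = refl

∧-elimʳ : ∀ {x y} → x ∧ y ≡ true → y ≡ true
∧-elimʳ {true} e = e

∧-intro : ∀ {x y} → x ≡ true → y ≡ true → x ∧ y ≡ true
∧-intro refl refl = refl

==-refl : ∀ {n} (x : Fin n) → (x == x) ≡ true
==-refl x with x ≟ᶠ x
... | yes _  = refl
... | no x≢x = ⊥-elim (x≢x refl)

==-distinct : ∀ {n} {x y : Fin n} → x ≢ y → (x == y) ≡ false
==-distinct {x = x} {y} x≢y with x ≟ᶠ y
... | yes x≡y = ⊥-elim (x≢y x≡y)
... | no _    = refl

module _ {n : ℕ} (G : Graph n) {m : ℕ} where

  occ-hit : ∀ {a x : Fin m} xs → x ≡ a → occ G a (x ∷ xs) ≡ suc (occ G a xs)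
  occ-hit {a} _ x≡a = cong length (filter-accept (_≟ᶠ a) x≡a)

  occ-miss : ∀ {a x : Fin m} xs → x ≢ a → occ G a (x ∷ xs) ≡ occ G a xs
  occ-miss {a} _ x≢a = cong length (filter-reject (_≟ᶠ a) x≢a)

  occ-single : (a : Fin m) → occ G a (a ∷ []) ≡ 1
  occ-single a = occ-hit {a} [] refl

  occ-pair : (a b : Fin m) → b ≢ a → occ G a (a ∷ b ∷ []) ≡ 1
  occ-pair a b b≢a = trans (occ-hit {a} (b ∷ []) refl) (cong suc (occ-miss [] b≢a))

  occ-twice : (a x : Fin m) → occ G a (x ∷ x ∷ []) ≢ 1
  occ-twice a x once = split (x ≟ᶠ a)
    where
    split : Dec (x ≡ a) → ⊥
    split (yes x≡a) with trans (sym (trans (occ-hit (x ∷ []) x≡a) (cong suc (occ-hit [] x≡a)))) once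
    ... | ()
    split (no x≢a) with trans (sym (trans (occ-miss (x ∷ []) x≢a) (occ-miss [] x≢a))) once
    ... | ()

last-vertex : ∀ {n} (G : Graph n) {P : Fin n → Set} {u v} (p : Walk G u v) →
  All P (vertices G p) → P v
last-vertex G here       (Pv ∷ _)  = Pv
last-vertex G (step _ p) (_ ∷ Pps) = last-vertex G p Pps

path-not-closed : ∀ {n} (G : Graph n) {u w} (e : adj G u w ≡ true) (q : Walk G w u) →
  ¬ IsPath G (step e q)
path-not-closed G e q (u∉q ∷ _) = last-vertex G q u∉q refl

unreachable : ∀ {n} (G : Graph n) {u v} → (∀ x → adj G x v ≡ true → ⊥) →
  Walk G u v → u ≡ v
unreachable G noIn here = refl
unreachable G noIn (step e p) with unreachable G noIn p
... | refl = ⊥-elim (noIn _ e)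

first-edge : ∀ {n} (G : Graph n) {u v} → Walk G u v → u ≢ v →
  Σ (Fin n) λ w → adj G u w ≡ true
first-edge G here       u≢u = ⊥-elim (u≢u refl)
first-edge G (step e _) _   = _ , e

induced-adj : ∀ {n} (G : Graph n) (S : Fin n → Bool) {x y} →
  adj (induced G S) x y ≡ true → S x ≡ true × S y ≡ true × adj G x y ≡ true
induced-adj G S {x} e = ∧-elimˡ e , ∧-elimˡ (∧-elimʳ {S x} e) , ∧-elimʳ (∧-elimʳ {S x} e)

module _ {k : ℕ} (G : Graph (suc k)) where

  SubgraphOfStar : Set
  SubgraphOfStar = ∀ x y → adj G x y ≡ true → adj (star k) x y ≡ true

  Leaf : Fin k → Set
  Leaf j = vert G (fsuc j) ≡ true

  SpokesPresent : Set
  SpokesPresent = ∀ j → Leaf j → adj G fzero (fsuc j) ≡ true × adj G (fsuc j) fzero ≡ true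

star-edge-centre : ∀ {k} {x y : Fin (suc k)} → adj (star k) x y ≡ true →
  x ≡ fzero ⊎ y ≡ fzero
star-edge-centre {x = fzero}  _ = inj₁ refl
star-edge-centre {x = fsuc _} {fzero} _ = inj₂ refl

module _ {k : ℕ} {G : Graph (suc k)} (sub : SubgraphOfStar G) where

  -- the only path between two distinct leaves goes through the centre
  leaf-path-colors : ∀ {m} (c : Fin (suc k) → Fin (suc k) → Fin m) {j j' : Fin k} →
    j ≢ j' → (p : Walk G (fsuc j) (fsuc j')) → IsPath G p →
    colors G c p ≡ c (fsuc j) fzero ∷ c fzero (fsuc j') ∷ []
  leaf-path-colors c j≢j here _ = ⊥-elim (j≢j refl)
  leaf-path-colors c _ (step {w = fsuc _} e _) _ = ⊥-elim (false≢true (sub _ _ e))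
  leaf-path-colors c _ (step {w = fzero} _ (step {w = fzero} e _)) _ =
    ⊥-elim (false≢true (sub _ _ e))
  leaf-path-colors c _ (step {w = fzero} _ (step {w = fsuc _} _ here)) _ = refl
  leaf-path-colors c _ (step {w = fzero} _ (step {w = fsuc _} _ (step {w = fsuc _} e _))) _ =
    ⊥-elim (false≢true (sub _ _ e))
  leaf-path-colors c _ (step {w = fzero} _ (step {w = fsuc _} _ (step {w = fzero} _ (step _ _))))
    (_ ∷ ((_ ∷ 0≢0 ∷ _) ∷ _)) = ⊥-elim (0≢0 refl)

  -- a substar has no cycle: a cycle uses an edge at the centre, and the
  -- remaining path of length ≥ 2 would have to pass the centre twice
  substar-acyclic : ¬ HasCycle G
  substar-acyclic (fzero , fsuc _ , _ , step {w = fsuc _} e _ , _) = false≢true (sub _ _ e)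
  substar-acyclic (fzero , fsuc _ , _ , step {w = fzero} _ here , s≤s () , _)
  substar-acyclic (fzero , fsuc _ , _ , step {w = fzero} _ (step e q) , _ , (_ ∷ isPath)) =
    path-not-closed G e q isPath
  substar-acyclic (fsuc _ , fzero , _ , step {w = fzero} e _ , _) = false≢true (sub _ _ e)
  substar-acyclic (fsuc _ , fzero , _ , step {w = fsuc _} _ here , s≤s () , _)
  substar-acyclic (fsuc _ , fzero , _ , step {w = fsuc _} _ (step {w = fsuc _} e _) , _) =
    false≢true (sub _ _ e)
  substar-acyclic (fsuc _ , fzero , _ , step {w = fsuc _} _ (step {w = fzero} _ (step _ _)) , _ ,
                   ((_ ∷ 0≢0 ∷ _) ∷ _)) = 0≢0 refl
  substar-acyclic (fzero , fzero , e , _) = false≢true (sub _ _ e)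
  substar-acyclic (fsuc _ , fsuc _ , e , _) = false≢true (sub _ _ e)

  spokes-distinct : ∀ {m} (C : CFColoring G m) {j j' : Fin k} → Leaf G j → Leaf G j' →
    j ≢ j' → proj₁ C fzero (fsuc j) ≢ proj₁ C fzero (fsuc j')
  spokes-distinct {m} (c , c-sym , cf) {j} {j'} Lj Lj' j≢j' same
    with cf (fsuc j) (fsuc j') Lj Lj' (j≢j' ∘ suc-injective)
  ... | p , isPath , a , once = occ-twice G a x (subst (λ cs → occ G a cs ≡ 1) repeated once)
    where
    x : Fin m
    x = c fzero (fsuc j')
    repeated : colors G c p ≡ x ∷ x ∷ []
    repeated = trans (leaf-path-colors c j≢j' p isPath)
                     (cong (λ y → y ∷ x ∷ []) (trans (c-sym _ _) same))

  cfc-lower-bound : ∀ {m r} → CFColoring G m → (g : Fin r → Fin k) →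
    Injective _≡_ _≡_ g → (∀ t → Leaf G (g t)) → r ≤ m
  cfc-lower-bound C g g-inj leaf = injective⇒≤ spoke-inj
    where
    spoke-inj : ∀ {t t'} → proj₁ C fzero (fsuc (g t)) ≡ proj₁ C fzero (fsuc (g t')) → t ≡ t'
    spoke-inj {t} {t'} same with t ≟ᶠ t'
    ... | yes t≡t' = t≡t'
    ... | no t≢t'  = ⊥-elim (spokes-distinct C (leaf t) (leaf t') (t≢t' ∘ g-inj) same)

-- the spoke to leaf j gets colour f j; non-edges get an arbitrary colour
spokeColouring : ∀ {k m} → (Fin k → Fin (suc m)) → Fin (suc k) → Fin (suc k) → Fin (suc m)
spokeColouring f fzero    fzero    = fzero
spokeColouring f fzero    (fsuc j) = f j
spokeColouring f (fsuc j) fzero    = f j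
spokeColouring f (fsuc _) (fsuc _) = fzero

spokeColouring-sym : ∀ {k m} (f : Fin k → Fin (suc m)) u v →
  spokeColouring f u v ≡ spokeColouring f v u
spokeColouring-sym f fzero    fzero    = refl
spokeColouring-sym f fzero    (fsuc _) = refl
spokeColouring-sym f (fsuc _) fzero    = refl
spokeColouring-sym f (fsuc _) (fsuc _) = refl

module _ {k m : ℕ} {G : Graph (suc k)} (spokes : SpokesPresent G)
         (f : Fin k → Fin (suc m))
         (f-inj : ∀ {j j'} → Leaf G j → Leaf G j' → f j ≡ f j' → j ≡ j') where

  spokeColouring-cf : ∀ u v → vert G u ≡ true → vert G v ≡ true → u ≢ v →
    CFPath G (spokeColouring f) u v
  spokeColouring-cf fzero fzero _ _ 0≢0 = ⊥-elim (0≢0 refl)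
  spokeColouring-cf fzero (fsuc j) _ Lj _ =
    step (proj₁ (spokes j Lj)) here , ((λ ()) ∷ []) ∷ [] ∷ [] , f j , occ-single G (f j)
  spokeColouring-cf (fsuc j) fzero Lj _ _ =
    step (proj₂ (spokes j Lj)) here , ((λ ()) ∷ []) ∷ [] ∷ [] , f j , occ-single G (f j)
  spokeColouring-cf (fsuc j) (fsuc j') Lj Lj' j≢j' =
    step (proj₂ (spokes j Lj)) (step (proj₁ (spokes j' Lj')) here) ,
    ((λ ()) ∷ j≢j' ∷ []) ∷ ((λ ()) ∷ []) ∷ [] ∷ [] ,
    f j , occ-pair G (f j) (f j') (λ same → j≢j' (cong fsuc (f-inj Lj Lj' (sym same))))

  spokeColouring-CF : CFColoring G (suc m)
  spokeColouring-CF = spokeColouring f , spokeColouring-sym f , spokeColouring-cf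

-- cfc of a substar containing all its spokes is its number of leaves
substar-isCfc : ∀ {k m} {G : Graph (suc k)} → SubgraphOfStar G → SpokesPresent G →
  (f : Fin k → Fin (suc m)) → (∀ {j j'} → Leaf G j → Leaf G j' → f j ≡ f j' → j ≡ j') →
  (g : Fin (suc m) → Fin k) → Injective _≡_ _≡_ g → (∀ t → Leaf G (g t)) →
  IsCfc G (suc m)
substar-isCfc sub spokes f f-inj g g-inj leaf =
  spokeColouring-CF spokes f f-inj , λ _ C → cfc-lower-bound sub C g g-inj leaf

star-substar : ∀ {k} → SubgraphOfStar (star k)
star-substar _ _ e = e

star-spokes : ∀ {k} → SpokesPresent (star k)
star-spokes _ _ = refl , refl

star-connected : ∀ {k} → Connected (star k)
star-connected fzero    fzero    _ _ = here
star-connected fzero    (fsuc _) _ _ = step refl here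
star-connected (fsuc _) fzero    _ _ = step refl here
star-connected (fsuc _) (fsuc _) _ _ = step refl (step refl here)

star-nontrivial : ∀ {k} → Nontrivial (star (suc k))
star-nontrivial = fzero , fsuc fzero , refl , refl , λ ()

star-isCfc : ∀ {m} → IsCfc (star (suc m)) (suc m)
star-isCfc = substar-isCfc star-substar star-spokes (λ j → j) (λ _ _ same → same)
                           (λ t → t) (λ same → same) (λ _ → refl)

IsSpoke : ∀ {k} → Fin k → Fin (suc k) → Fin (suc k) → Bool
IsSpoke i x y = (x == fzero ∧ y == fsuc i) ∨ (x == fsuc i ∧ y == fzero)

record StarMinusSpoke {k : ℕ} (i : Fin k) (R : Graph (suc k)) : Set where
  field
    substar  : SubgraphOfStar R
    isolated : ∀ x → adj R x (fsuc i) ≡ true → ⊥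
    spokes   : ∀ j → j ≢ i → adj R fzero (fsuc j) ≡ true × adj R (fsuc j) fzero ≡ true

starMinusSpoke : ∀ {k} {i : Fin k} {R : Graph (suc k)} →
  (∀ x y → adj R x y ≡ adj (star k) x y ∧ not (IsSpoke i x y)) → StarMinusSpoke i R
starMinusSpoke {i = i} {R} adjR = record
  { substar  = λ x y e → ∧-elimˡ (trans (sym (adjR x y)) e)
  ; isolated = isolated
  ; spokes   = λ j j≢i → let i≠j = ==-distinct (j≢i ∘ suc-injective) in
                 trans (adjR _ _) (cong (λ b → not (b ∨ false)) i≠j) ,
                 trans (adjR _ _) (cong (λ b → not (b ∧ true)) i≠j)
  }
  where
  isolated : ∀ x → adj R x (fsuc i) ≡ true → ⊥
  isolated fzero    e = false≢true
    (trans (sym (trans (adjR _ _) (cong (λ b → not (b ∨ false)) (==-refl (fsuc i))))) e)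
  isolated (fsuc _) e = false≢true (trans (sym (adjR _ _)) e)

deleted-spoke : ∀ {k} {a b : Fin (suc k)} → adj (star k) a b ≡ true →
  Σ (Fin k) λ i → StarMinusSpoke i (removeEdge (star k) a b)
deleted-spoke {a = fzero}  {fsuc i} _ = i , starMinusSpoke (λ _ _ → refl)
deleted-spoke {a = fsuc i} {fzero}  _ =
  i , starMinusSpoke (λ x y → cong (λ b → adj (star _) x y ∧ not b)
                                    (∨-comm (x == fsuc i ∧ y == fzero) _))

-- relabel the leaves other than i by Fin (suc m) (leaf i gets label 0)
skip : ∀ {m} → Fin (suc (suc m)) → Fin (suc (suc m)) → Fin (suc m)
skip i j with i ≟ᶠ j
... | yes _   = fzero
... | no i≢j  = punchOut i≢j

skip-injective : ∀ {m} (i : Fin (suc (suc m))) {j j'} → j ≢ i → j' ≢ i →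
  skip i j ≡ skip i j' → j ≡ j'
skip-injective i {j} {j'} j≢i j'≢i same with i ≟ᶠ j | i ≟ᶠ j'
... | yes i≡j | _        = ⊥-elim (j≢i (sym i≡j))
... | no _    | yes i≡j' = ⊥-elim (j'≢i (sym i≡j'))
... | no i≢j  | no i≢j'  = punchOut-injective i≢j i≢j' same

-- a nontrivial component S of K_{1,k} minus the spoke to leaf i consists of
-- the centre and exactly the leaves other than i
module Component {k : ℕ} {i : Fin k} {R : Graph (suc k)} (hR : StarMinusSpoke i R)
                 {S : Fin (suc k) → Bool} (comp : IsComponent R S)
                 (nt : Nontrivial (induced R S)) where

  open StarMinusSpoke hR

  H : Graph (suc k)
  H = induced R S

  private
    connected : Connected H
    connected = proj₂ (proj₂ (proj₂ comp))

    closed : ∀ x y → S x ≡ true → adj R x y ≡ true → S y ≡ true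
    closed = proj₁ (proj₂ (proj₂ comp))

    u v : Fin (suc k)
    u = proj₁ nt
    v = proj₁ (proj₂ nt)

    Su : S u ≡ true
    Su = proj₁ (proj₂ (proj₂ nt))

    Sv : S v ≡ true
    Sv = proj₁ (proj₂ (proj₂ (proj₂ nt)))

    u≢v : u ≢ v
    u≢v = proj₂ (proj₂ (proj₂ (proj₂ nt)))

    no-edge-in : ∀ x → adj H x (fsuc i) ≡ true → ⊥
    no-edge-in x e = isolated x (proj₂ (proj₂ (induced-adj R S e)))

  H-substar : SubgraphOfStar H
  H-substar x y e = substar x y (proj₂ (proj₂ (induced-adj R S e)))

  -- the isolated leaf i cannot be reached from the other vertex of S
  removed-leaf-excluded : S (fsuc i) ≢ true
  removed-leaf-excluded Si with u ≟ᶠ fsuc i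
  ... | yes refl = u≢v (sym (unreachable H no-edge-in (connected v (fsuc i) Sv Si)))
  ... | no u≢i   = u≢i (unreachable H no-edge-in (connected u (fsuc i) Su Si))

  -- S has an edge, and every edge of a substar touches the centre
  centre-included : S fzero ≡ true
  centre-included with first-edge H (connected u v Su Sv) u≢v
  ... | w , e with induced-adj R S e
  ... | Su' , Sw , eR with star-edge-centre {x = u} {w} (substar _ _ eR)
  ...   | inj₁ u≡0 = subst (λ x → S x ≡ true) u≡0 Su'
  ...   | inj₂ w≡0 = subst (λ x → S x ≡ true) w≡0 Sw

  leaf-included : ∀ j → j ≢ i → S (fsuc j) ≡ true
  leaf-included j j≢i = closed fzero (fsuc j) centre-included (proj₁ (spokes j j≢i))

  leaf-not-removed : ∀ {j} → S (fsuc j) ≡ true → j ≢ i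
  leaf-not-removed Sj refl = removed-leaf-excluded Sj

  H-spokes : SpokesPresent H
  H-spokes j Sj = ∧-intro centre-included (∧-intro Sj (proj₁ (spokes j j≢i))) ,
                  ∧-intro Sj (∧-intro centre-included (proj₂ (spokes j j≢i)))
    where j≢i = leaf-not-removed Sj

component-cfc : ∀ {k} {i : Fin k} {R : Graph (suc k)} → StarMinusSpoke i R →
  ∀ {S} → IsComponent R S → Nontrivial (induced R S) →
  Σ ℕ λ j → IsCfc (induced R S) j × j < k
component-cfc {suc zero} {fzero} hR {S} comp nt@(u , v , Su , Sv , u≢v) =
  ⊥-elim (twoVertices u v Su Sv u≢v)
  where
  open Component hR comp nt
  -- with k = 1 the only other vertex is the isolated leaf
  twoVertices : ∀ x y → S x ≡ true → S y ≡ true → x ≢ y → ⊥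
  twoVertices fzero        fzero        _  _  x≢y = x≢y refl
  twoVertices (fsuc fzero) _            Sx _  _   = removed-leaf-excluded Sx
  twoVertices fzero        (fsuc fzero) _  Sy _   = removed-leaf-excluded Sy
component-cfc {suc (suc m)} {i} hR comp nt =
  suc m ,
  substar-isCfc H-substar H-spokes
    (skip i) (λ Sj Sj' → skip-injective i (leaf-not-removed Sj) (leaf-not-removed Sj'))
    (punchIn i) (punchIn-injective i _ _) (λ t → leaf-included (punchIn i t) (punchInᵢ≢i i t)) ,
  ≤-refl
  where open Component hR comp nt

proposition4p1 : (k : ℕ) → 1 ≤ k → KCfcCritical k (star k)
proposition4p1 (suc m) _ =
  (star-connected , substar-acyclic star-substar) ,
  star-nontrivial ,
  star-isCfc ,
  λ _ _ e S comp nt → component-cfc (proj₂ (deleted-spoke e)) comp nt
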